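{- Let $\mathbb J$ be an $H$-subgraph of $\mathbb G$, let $U\subseteq V(\mathbb J)$ be $\mathbb J$-stable, and let $\mathrm{Spine}_{\mathbb J}(U)=\{(\mathbb G_i,U_i)\}_{i=1}^s$. Then: (1) $\mathrm{Spine}_{\mathbb J}(U)=\emptyset$ if and only if $U=V(\mathbb J)$; (2) if $U\ne V(\mathbb J)$, then for every $i\in[s]$ the set $U\cup\{\mathrm{Nadir}(\mathbb G_i,U_i)\}$ is $\mathbb J$-stable; (3) the set $\{\min V(\mathbb J)\}$ (minimum with respect to $\le$) is $\mathbb J$-stable.
   Context: Fixed: a connected graph $H$ and an ordered graph $\mathbb G=(G,\le)$ ($\le$ a total order on $V(G)$); ordered subgraphs carry the restricted order. An $H$-subgraph is an ordered subgraph $\mathbb J$ of $\mathbb G$ isomorphic to $H$. For an $H$-subgraph $\mathbb J$ and an ordered subgraph $\mathbb G'$ of $\mathbb J$, a prefix of $\mathbb G'$ is a non-empty $D\subseteq V(\mathbb G')$ with: (1) every $u\in D$ has a neighbour $v\in V(\mathbb G')\setminus D$ with $uv\in E(\mathbb G')$; (2) $v>u$ for all $u\in D$, $v\in V(\mathbb G')\setminus D$; (3) every vertex of $\mathbb G'$ with a neighbour in $V(\mathbb J)\setminus V(\mathbb G')$ lies in $D$. A useful pair (with respect to $\mathbb J$) is $(\mathbb G',U_{\mathbb G'})$ with $\mathbb G'$ an induced ordered subgraph of $\mathbb J$, $U_{\mathbb G'}$ a prefix of $\mathbb G'$, and $\mathbb J[V(\mathbb G')\setminus U_{\mathbb G'}]$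 connected. The nadir $\mathrm{Nadir}(\mathbb G',U_{\mathbb G'})$ is the $\le$-smallest vertex of $V(\mathbb G')\setminus U_{\mathbb G'}$. For $U\subseteq V(\mathbb J)$, $\mathrm{Spine}_{\mathbb J}(U)$ is the family of all useful pairs $(\mathbb G_i,U_i)$ with respect to $\mathbb J$ such that $\mathbb G_i$ is an ordered subgraph of $\mathbb J$ and $V(\mathbb G_i)\cap U=U_i$. $U$ is $\mathbb J$-stable if for every $w\in V(\mathbb J)\setminus U$ there is a member $(\mathbb G_i,U_i)$ of $\mathrm{Spine}_{\mathbb J}(U)$ with $w\in V(\mathbb G_i)\setminus U_i$. -}

module Defs where

open import Data.Nat using (ℕ)
open import Data.Fin using (Fin; _<_; _≤_)
open import Data.Fin.Subset using (Subset; _∈_; _∉_; _⊆_; _∩_; _∪_; _─_; ⁅_⁆; ⊤; Nonempty)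
open import Data.Product using (Σ; ∃; _×_; _,_)
open import Relation.Nullary using (¬_; Dec)
open import Relation.Binary.PropositionalEquality using (_≡_)
open import Function.Definitions using (Injective)

-- An ordered graph (G , ≤) is a graph on Fin n, ordered by the usual order of Fin n
-- (every finite totally ordered vertex set is order-isomorphic to some Fin n).
record Graph (n : ℕ) : Set₁ where
  field
    Adj    : Fin n → Fin n → Set
    adj?   : ∀ x y → Dec (Adj x y)
    sym    : ∀ {x y} → Adj x y → Adj y x
    irrefl : ∀ {x} → ¬ Adj x x
open Graph public

data Reach {n : ℕ} (E : Fin n → Fin n → Set) (S : Subset n) : Fin n → Fin n → Set where
  here : ∀ {x} → x ∈ S → Reach E S x x
  step : ∀ {x y z} → x ∈ S → E x y → Reach E S y z → Reach E S x z

ConnectedOn : {n : ℕ} → (Fin n → Fin n → Set) → Subset n → Set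
ConnectedOn E S = Nonempty S × (∀ x y → x ∈ S → y ∈ S → Reach E S x y)

Connected : {n : ℕ} → Graph n → Set
Connected {n} H = ConnectedOn (Adj H) ⊤

record HSubgraph {n m : ℕ} (G : Graph n) (H : Graph m) : Set₁ where
  field
    V       : Subset n
    E       : Fin n → Fin n → Set
    E?      : ∀ x y → Dec (E x y)
    E-sym   : ∀ {x y} → E x y → E y x
    E⊆G     : ∀ {x y} → E x y → Adj G x y
    E-left  : ∀ {x y} → E x y → x ∈ V
    E-right : ∀ {x y} → E x y → y ∈ V
    iso     : Fin m → Fin n
    iso-inj : Injective _≡_ _≡_ iso
    iso-in  : ∀ a → iso a ∈ V
    iso-sur : ∀ x → x ∈ V → ∃ λ a → iso a ≡ x
    iso-adj : ∀ a b → Adj H a b → E (iso a) (iso b)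
    iso-adj⁻ : ∀ a b → E (iso a) (iso b) → Adj H a b
open HSubgraph public

module _ {n m : ℕ} {G : Graph n} {H : Graph m} (J : HSubgraph G H) where

  IsPrefix : Subset n → Subset n → Set
  IsPrefix W D =
      D ⊆ W
    × Nonempty D
    × (∀ u → u ∈ D → ∃ λ v → v ∈ W × v ∉ D × E J u v)
    × (∀ u v → u ∈ D → v ∈ W → v ∉ D → u < v)
    × (∀ u v → u ∈ W → E J u v → v ∉ W → u ∈ D)

  -- (𝕁[W] , D) is a useful pair with respect to 𝕁.
  -- (An induced ordered subgraph of 𝕁 is determined by its vertex set W ⊆ V(𝕁).)
  Useful : Subset n → Subset n → Set
  Useful W D = W ⊆ V J × IsPrefix W D × ConnectedOn (E J) (W ─ D)

  InSpine : Subset n → Subset n → Subset n → Set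
  InSpine U W D = Useful W D × (W ∩ U ≡ D)

  Stable : Subset n → Set
  Stable U = ∀ w → w ∈ V J → w ∉ U →
    ∃ λ W → ∃ λ D → InSpine U W D × w ∈ W × w ∉ D

IsMin : {n : ℕ} → Fin n → Subset n → Set
IsMin x S = x ∈ S × (∀ y → y ∈ S → x ≤ y)

{-# OPTIONS --safe #-}
module Submission where

-- Let S ⊆ V(𝕁) have minimum x, let every edge leaving S
-- end in a set P lying below S, and let w ∈ S - x be joined to x inside S. Then for the
-- component C of w in S - x and D = {x} ∪ {p ∈ P adjacent to C}, the pair (𝕁[D ∪ C], D) is
-- useful, and it lies in Spine(U) whenever P ∪ {x} ⊆ U and S ∩ U = {x}.
-- (3) is the case S = V(𝕁), P = ∅, U = {x}. In (2), a vertex w ∉ U in the body W ∖ D of the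
-- given pair is reached with S = W ∖ D, P = D; any other w keeps its old pair (W', D'), which
-- misses the nadir x: bodies are closed under edges avoiding U, so otherwise the body of
-- (W', D'), and with it w, would lie inside W ∖ D. For (1), a useful pair has a body vertex,
-- and it lies outside U.

open import Defs
open import Data.Nat using (ℕ)
open import Data.Fin using (Fin; _<_)
open import Data.Fin.Properties using (any?; ≤∧≢⇒<; <-irrefl) renaming (_≟_ to _≟ᶠ_)
open import Data.Fin.Subset using (Subset; inside; _∈_; _∉_; _⊆_; _⊃_; _∩_; _∪_; _─_; _-_; ⁅_⁆; ⊥)
open import Data.Fin.Subset.Properties
  using (_∈?_; _⊂?_; ⊆-antisym; ⊥⊆; ∉⊥; ∈⊤; x∈⁅x⁆; x∈⁅y⁆⇒x≡y; x∈p∩q⁺; x∈p∩q⁻; x∈p∪q⁻;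
         p⊆p∪q; q⊆p∪q; x∈p∧x∉q⇒x∈p─q; p─q⊆p; x∈p∧x≢y⇒x∈p-y)
open import Data.Fin.Subset.Induction using (⊃-wellFounded)
open import Induction.WellFounded using (Acc; acc)
open import Data.Vec using (_∷_; tabulate; here; there)
open import Data.Vec.Properties using (lookup∘tabulate; lookup⇒[]=; []=⇒lookup)
open import Data.Product using (∃; _×_; _,_; proj₁; proj₂)
open import Data.Bool using (true)
open import Data.Sum using (_⊎_; inj₁; inj₂)
open import Data.Empty using (⊥-elim)
open import Function using (_∘_)
open import Function.Bundles using (_⇔_; mk⇔)
open import Relation.Unary using (Decidable)
open import Relation.Nullary using (¬_; Dec; yes; no; does; proof)
open import Relation.Nullary.Reflects using (Reflects; invert)
open import Relation.Nullary.Decidable using (dec-true; _×-dec_; _⊎-dec_)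
open import Relation.Binary.PropositionalEquality using (_≡_; _≢_; refl; trans; subst)
import Relation.Binary.PropositionalEquality as ≡

x∈p─q⇒x∉q : ∀ {n} {p q : Subset n} {x} → x ∈ p ─ q → x ∉ q
x∈p─q⇒x∉q {p = _ ∷ _} {inside ∷ _} () here
x∈p─q⇒x∉q {p = _ ∷ p} {_ ∷ q} (there x∈p─q) (there x∈q) = x∈p─q⇒x∉q {p = p} {q} x∈p─q x∈q

module _ {n : ℕ} where

  x∈p-y⇒x≢y : ∀ {p : Subset n} {x y} → x ∈ p - y → x ≢ y
  x∈p-y⇒x≢y {y = y} x∈p-y refl = x∈p─q⇒x∉q x∈p-y (x∈⁅x⁆ y)

  filter : {P : Fin n → Set} → Decidable P → Subset n
  filter P? = tabulate (does ∘ P?)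

  ∈-filter⁺ : ∀ {P : Fin n → Set} (P? : Decidable P) {x} → P x → x ∈ filter P?
  ∈-filter⁺ P? {x} px = lookup⇒[]= x _ (trans (lookup∘tabulate _ x) (dec-true (P? x) px))

  ∈-filter⁻ : ∀ {P : Fin n → Set} (P? : Decidable P) {x} → x ∈ filter P? → P x
  ∈-filter⁻ P? {x} x∈ = invert (subst (Reflects _) does≡true (proof (P? x)))
    where
      does≡true : does (P? x) ≡ true
      does≡true = trans (≡.sym (lookup∘tabulate _ x)) ([]=⇒lookup x∈)

module _ {n : ℕ} {E : Fin n → Fin n → Set} where

  reach-source∈ : ∀ {S a b} → Reach E S a b → a ∈ S
  reach-source∈ (here a∈S) = a∈S
  reach-source∈ (step a∈S _ _) = a∈S

  reach-snoc : ∀ {S a b c} → Reach E S a b → E b c → c ∈ S → Reach E S a c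
  reach-snoc (here a∈S) e c∈S = step a∈S e (here c∈S)
  reach-snoc (step a∈S e r) e′ c∈S = step a∈S e (reach-snoc r e′ c∈S)

  reach-trans : ∀ {S a b c} → Reach E S a b → Reach E S b c → Reach E S a c
  reach-trans (here _) r′ = r′
  reach-trans (step a∈S e r) r′ = step a∈S e (reach-trans r r′)

  reach-sym : (∀ {x y} → E x y → E y x) → ∀ {S a b} → Reach E S a b → Reach E S b a
  reach-sym E-sym (here a∈S) = here a∈S
  reach-sym E-sym (step a∈S e r) = reach-snoc (reach-sym E-sym r) (E-sym e) a∈S

  reach-mono : ∀ {S S′} → S ⊆ S′ → ∀ {a b} → Reach E S a b → Reach E S′ a b
  reach-mono S⊆S′ (here a∈S) = here (S⊆S′ a∈S)
  reach-mono S⊆S′ (step a∈S e r) = step (S⊆S′ a∈S) e (reach-mono S⊆S′ r)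

  connectedOn-fromHub : (∀ {x y} → E x y → E y x) → ∀ {S h} → h ∈ S →
    (∀ {v} → v ∈ S → Reach E S h v) → ConnectedOn E S
  connectedOn-fromHub E-sym h∈S reach =
    (_ , h∈S) , λ _ _ a∈S b∈S → reach-trans (reach-sym E-sym (reach a∈S)) (reach b∈S)

record Component {n : ℕ} (E : Fin n → Fin n → Set) (T : Subset n) (w : Fin n) : Set where
  field
    carrier   : Subset n
    source∈   : w ∈ carrier
    carrier⊆T : carrier ⊆ T
    closed    : ∀ {u v} → u ∈ carrier → v ∈ T → E u v → v ∈ carrier
    reach     : ∀ {v} → v ∈ carrier → Reach E carrier w v

module _ {n : ℕ} {E : Fin n → Fin n → Set} (E? : ∀ x y → Dec (E x y)) (T : Subset n) (w : Fin n) where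

  private
    Frontier : Subset n → Fin n → Set
    Frontier R v = v ∈ T × ∃ λ u → u ∈ R × E u v

    frontier? : ∀ R → Decidable (Frontier R)
    frontier? R v = (v ∈? T) ×-dec any? (λ u → (u ∈? R) ×-dec E? u v)

    expand : Subset n → Subset n
    expand R = R ∪ filter (frontier? R)

  component-from : ∀ R → Acc _⊃_ R → w ∈ R → R ⊆ T → (∀ {v} → v ∈ R → Reach E R w v) →
    Component E T w
  component-from R (acc larger) w∈R R⊆T reach with R ⊂? expand R
  ... | yes R⊂R⁺ = component-from (expand R) (larger R⊂R⁺) (p⊆p∪q _ w∈R) R⁺⊆T reach⁺
    where
      R⁺⊆T : expand R ⊆ T
      R⁺⊆T v∈R⁺ with x∈p∪q⁻ R _ v∈R⁺
      ... | inj₁ v∈R = R⊆T v∈R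
      ... | inj₂ v∈F = proj₁ (∈-filter⁻ (frontier? R) v∈F)
      reach⁺ : ∀ {v} → v ∈ expand R → Reach E (expand R) w v
      reach⁺ v∈R⁺ with x∈p∪q⁻ R _ v∈R⁺
      ... | inj₁ v∈R = reach-mono (p⊆p∪q _) (reach v∈R)
      ... | inj₂ v∈F with ∈-filter⁻ (frontier? R) v∈F
      ... | _ , _ , u∈R , e = reach-snoc (reach-mono (p⊆p∪q _) (reach u∈R)) e v∈R⁺
  ... | no R⊄R⁺ = record
    { carrier = R ; source∈ = w∈R ; carrier⊆T = R⊆T ; closed = closed ; reach = reach }
    where
      closed : ∀ {u v} → u ∈ R → v ∈ T → E u v → v ∈ R
      closed {u} {v} u∈R v∈T e with v ∈? R
      ... | yes v∈R = v∈R
      ... | no v∉R = ⊥-elim (R⊄R⁺ (p⊆p∪q _ , v ,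
                       q⊆p∪q R _ (∈-filter⁺ (frontier? R) (v∈T , u , u∈R , e)) , v∉R))

  component : w ∈ T → Component E T w
  component w∈T = component-from ⁅ w ⁆ (⊃-wellFounded _) (x∈⁅x⁆ w) ⁅w⁆⊆T reach
    where
      ⁅w⁆⊆T : ⁅ w ⁆ ⊆ T
      ⁅w⁆⊆T v∈⁅w⁆ with x∈⁅y⁆⇒x≡y w v∈⁅w⁆
      ... | refl = w∈T
      reach : ∀ {v} → v ∈ ⁅ w ⁆ → Reach E ⁅ w ⁆ w v
      reach v∈⁅w⁆ with x∈⁅y⁆⇒x≡y w v∈⁅w⁆
      ... | refl = here v∈⁅w⁆

module _ {n m : ℕ} {G : Graph n} {H : Graph m} (J : HSubgraph G H) where

  SpineCovers : Subset n → Fin n → Set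
  SpineCovers U w = ∃ λ W → ∃ λ D → InSpine J U W D × w ∈ W × w ∉ D

  record Fenced (S P : Subset n) : Set where
    field
      S⊆V  : S ⊆ V J
      P⊆V  : P ⊆ V J
      exit : ∀ {u v} → u ∈ S → E J u v → v ∉ S → v ∈ P
      P<S  : ∀ {p v} → p ∈ P → v ∈ S → p < v

  V-fenced : Fenced (V J) ⊥
  V-fenced = record
    { S⊆V = λ v∈V → v∈V
    ; P⊆V = ⊥⊆
    ; exit = λ _ e v∉V → ⊥-elim (v∉V (E-right J e))
    ; P<S = λ p∈⊥ _ → ⊥-elim (∉⊥ p∈⊥) }

  useful⇒fenced : ∀ {W D} → Useful J W D → Fenced (W ─ D) D
  useful⇒fenced {W} {D} (W⊆V , (D⊆W , _ , _ , D<body , boundary⊆D) , _) = record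
    { S⊆V = W⊆V ∘ p─q⊆p W D
    ; P⊆V = W⊆V ∘ D⊆W
    ; exit = exit
    ; P<S = λ p∈D v∈body → D<body _ _ p∈D (p─q⊆p W D v∈body) (x∈p─q⇒x∉q v∈body) }
    where
      exit : ∀ {u v} → u ∈ W ─ D → E J u v → v ∉ W ─ D → v ∈ D
      exit {u} {v} u∈body e v∉body with v ∈? W | v ∈? D
      ... | _       | yes v∈D = v∈D
      ... | yes v∈W | no v∉D  = ⊥-elim (v∉body (x∈p∧x∉q⇒x∈p─q v∈W v∉D))
      ... | no v∉W  | no _    = ⊥-elim (x∈p─q⇒x∉q u∈body (boundary⊆D u v (p─q⊆p W D u∈body) e v∉W))

  module ComponentPair {S P : Subset n} {x w : Fin n} (fenced : Fenced S P) (x-min : IsMin x S)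
                       (comp : Component (E J) (S - x) w) where
    open Fenced fenced
    open Component comp renaming (carrier to C)

    C⊆S : C ⊆ S
    C⊆S v∈C = p─q⊆p S ⁅ x ⁆ (carrier⊆T v∈C)

    C≢x : ∀ {v} → v ∈ C → v ≢ x
    C≢x v∈C = x∈p-y⇒x≢y (carrier⊆T v∈C)

    Attached : Fin n → Set
    Attached v = v ≡ x ⊎ (v ∈ P × ∃ λ c → c ∈ C × E J v c)

    attached? : Decidable Attached
    attached? v = (v ≟ᶠ x) ⊎-dec ((v ∈? P) ×-dec any? (λ c → (c ∈? C) ×-dec E? J v c))

    D : Subset n
    D = filter attached?

    W : Subset n
    W = D ∪ C

    x∈D : x ∈ D
    x∈D = ∈-filter⁺ attached? (inj₁ refl)

    C∉D : ∀ {v} → v ∈ C → v ∉ D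
    C∉D v∈C v∈D with ∈-filter⁻ attached? v∈D
    ... | inj₁ v≡x       = C≢x v∈C v≡x
    ... | inj₂ (v∈P , _) = <-irrefl refl (P<S v∈P (C⊆S v∈C))

    w∈W : w ∈ W
    w∈W = q⊆p∪q D C source∈

    w∉D : w ∉ D
    w∉D = C∉D source∈

    W─D≡C : W ─ D ≡ C
    W─D≡C = ⊆-antisym body⊆C (λ v∈C → x∈p∧x∉q⇒x∈p─q (q⊆p∪q D C v∈C) (C∉D v∈C))
      where
        body⊆C : W ─ D ⊆ C
        body⊆C v∈body with x∈p∪q⁻ D C (p─q⊆p W D v∈body)
        ... | inj₁ v∈D = ⊥-elim (x∈p─q⇒x∉q v∈body v∈D)
        ... | inj₂ v∈C = v∈C

    neighbour∈W : ∀ {u v} → u ∈ C → E J u v → v ∈ W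
    neighbour∈W {u} {v} u∈C e with v ≟ᶠ x | v ∈? S
    ... | yes refl | _       = p⊆p∪q C x∈D
    ... | no v≢x   | yes v∈S = q⊆p∪q D C (closed u∈C (x∈p∧x≢y⇒x∈p-y v∈S v≢x) e)
    ... | no _     | no v∉S  =
      p⊆p∪q C (∈-filter⁺ attached? (inj₂ (exit (C⊆S u∈C) e v∉S , u , u∈C , E-sym J e)))

    x-adjacent : ∀ {y} → y ∈ C → Reach (E J) S y x → ∃ λ c → c ∈ C × E J x c
    x-adjacent y∈C (here _) = ⊥-elim (C≢x y∈C refl)
    x-adjacent {y} y∈C (step {y = z} _ e r) with z ≟ᶠ x
    ... | yes refl = y , y∈C , E-sym J e
    ... | no z≢x   = x-adjacent (closed y∈C (x∈p∧x≢y⇒x∈p-y (reach-source∈ r) z≢x) e) r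

    useful : Reach (E J) S w x → Useful J W D
    useful w⇝x =
      W⊆V , (p⊆p∪q C , (x , x∈D) , D-exits , D<body , boundary⊆D) ,
      subst (ConnectedOn (E J)) (≡.sym W─D≡C) (connectedOn-fromHub (E-sym J) source∈ reach)
      where
        W⊆V : W ⊆ V J
        W⊆V v∈W with x∈p∪q⁻ D C v∈W
        ... | inj₂ v∈C = S⊆V (C⊆S v∈C)
        ... | inj₁ v∈D with ∈-filter⁻ attached? v∈D
        ... | inj₁ refl      = S⊆V (proj₁ x-min)
        ... | inj₂ (v∈P , _) = P⊆V v∈P
        D-exits : ∀ u → u ∈ D → ∃ λ v → v ∈ W × v ∉ D × E J u v
        D-exits u u∈D with ∈-filter⁻ attached? u∈D
        ... | inj₁ refl = let c , c∈C , e = x-adjacent source∈ w⇝x in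
                          c , q⊆p∪q D C c∈C , C∉D c∈C , e
        ... | inj₂ (_ , c , c∈C , e) = c , q⊆p∪q D C c∈C , C∉D c∈C , e
        D<body : ∀ u v → u ∈ D → v ∈ W → v ∉ D → u < v
        D<body u v u∈D v∈W v∉D = below (∈-filter⁻ attached? u∈D)
          where
            v∈C : v ∈ C
            v∈C = subst (v ∈_) W─D≡C (x∈p∧x∉q⇒x∈p─q v∈W v∉D)
            below : Attached u → u < v
            below (inj₁ u≡x)       =
              subst (_< v) (≡.sym u≡x) (≤∧≢⇒< (proj₂ x-min v (C⊆S v∈C)) (C≢x v∈C ∘ ≡.sym))
            below (inj₂ (u∈P , _)) = P<S u∈P (C⊆S v∈C)
        boundary⊆D : ∀ u v → u ∈ W → E J u v → v ∉ W → u ∈ D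
        boundary⊆D u v u∈W e v∉W with x∈p∪q⁻ D C u∈W
        ... | inj₁ u∈D = u∈D
        ... | inj₂ u∈C = ⊥-elim (v∉W (neighbour∈W u∈C e))

    inSpine : ∀ {U} → P ⊆ U → x ∈ U → (∀ {v} → v ∈ S → v ∈ U → v ≡ x) →
      Reach (E J) S w x → InSpine J U W D
    inSpine {U} P⊆U x∈U S∩U⊆x w⇝x = useful w⇝x , ⊆-antisym W∩U⊆D D⊆W∩U
      where
        W∩U⊆D : W ∩ U ⊆ D
        W∩U⊆D v∈W∩U with x∈p∩q⁻ W U v∈W∩U
        ... | v∈W , v∈U with x∈p∪q⁻ D C v∈W
        ... | inj₁ v∈D = v∈D
        ... | inj₂ v∈C = ⊥-elim (C≢x v∈C (S∩U⊆x (C⊆S v∈C) v∈U))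
        D⊆U : D ⊆ U
        D⊆U v∈D with ∈-filter⁻ attached? v∈D
        ... | inj₁ refl      = x∈U
        ... | inj₂ (v∈P , _) = P⊆U v∈P
        D⊆W∩U : D ⊆ W ∩ U
        D⊆W∩U v∈D = x∈p∩q⁺ (p⊆p∪q C v∈D , D⊆U v∈D)

  SpineCovers-fenced : ∀ {S P U x w} → Fenced S P → IsMin x S →
    P ⊆ U → x ∈ U → (∀ {v} → v ∈ S → v ∈ U → v ≡ x) →
    w ∈ S → w ∉ U → Reach (E J) S w x → SpineCovers U w
  SpineCovers-fenced {S} {x = x} {w} fenced x-min P⊆U x∈U S∩U⊆x w∈S w∉U w⇝x =
    W , D , inSpine P⊆U x∈U S∩U⊆x w⇝x , w∈W , w∉D
    where
      w≢x : w ≢ x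
      w≢x refl = w∉U x∈U
      open ComponentPair fenced x-min (component (E? J) (S - x) w (x∈p∧x≢y⇒x∈p-y w∈S w≢x))

  body∉U : ∀ {U W D v} → InSpine J U W D → v ∈ W ─ D → v ∉ U
  body∉U {W = W} {D} {v} (_ , W∩U≡D) v∈body v∈U =
    x∈p─q⇒x∉q v∈body (subst (v ∈_) W∩U≡D (x∈p∩q⁺ (p─q⊆p W D v∈body , v∈U)))

  prefix⊆U : ∀ {U W D} → InSpine J U W D → D ⊆ U
  prefix⊆U {U} {W} (_ , W∩U≡D) {v} v∈D = proj₂ (x∈p∩q⁻ W U (subst (v ∈_) (≡.sym W∩U≡D) v∈D))

  body-closed : ∀ {U W D u v} → InSpine J U W D → u ∈ W ─ D → E J u v → v ∉ U → v ∈ W ─ D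
  body-closed {W = W} {D} {v = v} spine u∈body e v∉U with v ∈? W ─ D
  ... | yes v∈body = v∈body
  ... | no v∉body  =
    ⊥-elim (v∉U (prefix⊆U spine (Fenced.exit (useful⇒fenced (proj₁ spine)) u∈body e v∉body)))

  reach-stays-in-body : ∀ {U W D W′ D′ a b} → InSpine J U W D → InSpine J U W′ D′ →
    a ∈ W ─ D → Reach (E J) (W′ ─ D′) a b → b ∈ W ─ D
  reach-stays-in-body _ _ a∈body (here _) = a∈body
  reach-stays-in-body spine spine′ a∈body (step _ e r) =
    reach-stays-in-body spine spine′ (body-closed spine a∈body e (body∉U spine′ (reach-source∈ r))) r

  body⊆body : ∀ {U W D W′ D′ a} → InSpine J U W D → InSpine J U W′ D′ →
    a ∈ W ─ D → a ∈ W′ → W′ ─ D′ ⊆ W ─ D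
  body⊆body {W′ = W′} {D′} {a} spine spine′@((_ , _ , (_ , connected)) , _) a∈body a∈W′ b∈body′ =
    reach-stays-in-body spine spine′ a∈body (connected _ _ a∈body′ b∈body′)
    where
      a∈body′ : a ∈ W′ ─ D′
      a∈body′ = x∈p∧x∉q⇒x∈p─q a∈W′ (body∉U spine a∈body ∘ prefix⊆U spine′)

  InSpine-∪⁅⁆ : ∀ {U W D x} → InSpine J U W D → x ∉ W → InSpine J (U ∪ ⁅ x ⁆) W D
  InSpine-∪⁅⁆ {U} {W} {D} {x} (useful , W∩U≡D) x∉W = useful , ⊆-antisym W∩U′⊆D D⊆W∩U′
    where
      W∩U′⊆D : W ∩ (U ∪ ⁅ x ⁆) ⊆ D
      W∩U′⊆D {v} v∈W∩U′ with x∈p∩q⁻ W _ v∈W∩U′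
      ... | v∈W , v∈U′ with x∈p∪q⁻ U ⁅ x ⁆ v∈U′
      ... | inj₁ v∈U   = subst (v ∈_) W∩U≡D (x∈p∩q⁺ (v∈W , v∈U))
      ... | inj₂ v∈⁅x⁆ = ⊥-elim (x∉W (subst (_∈ W) (x∈⁅y⁆⇒x≡y x v∈⁅x⁆) v∈W))
      D⊆W∩U′ : D ⊆ W ∩ (U ∪ ⁅ x ⁆)
      D⊆W∩U′ {v} v∈D with x∈p∩q⁻ W U (subst (v ∈_) (≡.sym W∩U≡D) v∈D)
      ... | v∈W , v∈U = x∈p∩q⁺ (v∈W , p⊆p∪q ⁅ x ⁆ v∈U)

  InSpine⇒V⊈U : ∀ {U W D} → InSpine J U W D → ∃ λ a → a ∈ V J × a ∉ U
  InSpine⇒V⊈U {W = W} {D} spine@((W⊆V , _ , ((a , a∈body) , _)) , _) =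
    a , W⊆V (p─q⊆p W D a∈body) , body∉U spine a∈body

  noSpine⇔U≡V : ∀ {U} → U ⊆ V J → Stable J U →
    (¬ (∃ λ W → ∃ λ D → InSpine J U W D)) ⇔ (U ≡ V J)
  noSpine⇔U≡V {U} U⊆V stable = mk⇔ (λ none → ⊆-antisym U⊆V (V⊆U none)) spine-outside
    where
      V⊆U : ¬ (∃ λ W → ∃ λ D → InSpine J U W D) → V J ⊆ U
      V⊆U none {v} v∈V with v ∈? U
      ... | yes v∈U = v∈U
      ... | no v∉U  = let W , D , spine , _ = stable v v∈V v∉U in ⊥-elim (none (W , D , spine))
      spine-outside : U ≡ V J → ¬ (∃ λ W → ∃ λ D → InSpine J U W D)
      spine-outside U≡V (_ , _ , spine) =
        let a , a∈V , a∉U = InSpine⇒V⊈U spine in a∉U (subst (a ∈_) (≡.sym U≡V) a∈V)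

  Stable-∪-nadir : ∀ {U} → Stable J U → ∀ W D → InSpine J U W D →
    ∀ x → IsMin x (W ─ D) → Stable J (U ∪ ⁅ x ⁆)
  Stable-∪-nadir {U} stable W D spine@(useful , _) x x-min w w∈V w∉U′ with w ∈? W ─ D
  ... | yes w∈body =
    SpineCovers-fenced (useful⇒fenced useful) x-min (p⊆p∪q ⁅ x ⁆ ∘ prefix⊆U spine)
      (q⊆p∪q U ⁅ x ⁆ (x∈⁅x⁆ x)) body∩U′⊆x w∈body w∉U′
      (proj₂ (proj₂ (proj₂ useful)) w x w∈body (proj₁ x-min))
    where
      body∩U′⊆x : ∀ {v} → v ∈ W ─ D → v ∈ U ∪ ⁅ x ⁆ → v ≡ x
      body∩U′⊆x v∈body v∈U′ with x∈p∪q⁻ U ⁅ x ⁆ v∈U′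
      ... | inj₁ v∈U   = ⊥-elim (body∉U spine v∈body v∈U)
      ... | inj₂ v∈⁅x⁆ = x∈⁅y⁆⇒x≡y x v∈⁅x⁆
  ... | no w∉body =
    let W′ , D′ , spine′ , w∈W′ , w∉D′ = stable w w∈V (w∉U′ ∘ p⊆p∪q ⁅ x ⁆)
        w∈body′ = x∈p∧x∉q⇒x∈p─q w∈W′ w∉D′
    in W′ , D′ ,
       InSpine-∪⁅⁆ spine′ (λ x∈W′ → w∉body (body⊆body spine spine′ (proj₁ x-min) x∈W′ w∈body′)) ,
       w∈W′ , w∉D′

  Connected⇒Reach-V : Connected H → ∀ {a b} → a ∈ V J → b ∈ V J → Reach (E J) (V J) a b
  Connected⇒Reach-V (_ , connected) a∈V b∈V with iso-sur J _ a∈V | iso-sur J _ b∈V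
  ... | a′ , refl | b′ , refl = image (connected a′ b′ ∈⊤ ∈⊤)
    where
      image : ∀ {a b} → Reach (Adj H) _ a b → Reach (E J) (V J) (iso J a) (iso J b)
      image {a} (here _)     = here (iso-in J a)
      image {a} (step _ e r) = step (iso-in J a) (iso-adj J _ _ e) (image r)

  Stable-⁅min⁆ : Connected H → ∀ x → IsMin x (V J) → Stable J ⁅ x ⁆
  Stable-⁅min⁆ connected x x-min w w∈V w∉⁅x⁆ =
    SpineCovers-fenced V-fenced x-min ⊥⊆ (x∈⁅x⁆ x) (λ _ → x∈⁅y⁆⇒x≡y x) w∈V w∉⁅x⁆
      (Connected⇒Reach-V connected w∈V (proj₁ x-min))

lemma3 : {n m : ℕ} (G : Graph n) (H : Graph m) → Connected H →
    (J : HSubgraph G H) (U : Subset n) → U ⊆ V J → Stable J U →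
      ((¬ (∃ λ W → ∃ λ D → InSpine J U W D)) ⇔ (U ≡ V J))
    × (¬ (U ≡ V J) → ∀ W D → InSpine J U W D → ∀ x → IsMin x (W ─ D) →
        Stable J (U ∪ ⁅ x ⁆))
    × (∀ x → IsMin x (V J) → Stable J ⁅ x ⁆)
lemma3 G H connected J U U⊆V stable =
  noSpine⇔U≡V J U⊆V stable , (λ _ → Stable-∪-nadir J stable) , Stable-⁅min⁆ J connected
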